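{- Let $G$ be a simple disjunction or a simple formula, and let $X$ be a set of atoms. An interpretation $I$ satisfies $G^X_\bot$ if and only if it satisfies $FT(G,I)^X_\bot$.
   Context: Infinitary propositional formulas: atoms, arbitrary conjunctions $\mathcal H^\land$, disjunctions $\mathcal H^\lor$, implications; $\top=\emptyset^\land$, $\bot=\emptyset^\lor$, $\neg F=F\to\bot$; interpretations are sets of atoms with the usual satisfaction. FT-reduct: $FT(p,I)=p$ if $p\in I$, else $\bot$; $FT(\mathcal H^\land,I)=\{FT(F,I):F\in\mathcal H\}^\land$, likewise for $\lor$; $FT(F\to F',I)=\bot$ if $I\not\models F\to F'$, else $FT(F,I)\to FT(F',I)$. Extended literals: $p,\neg p,\neg\neg p$. A simple disjunction is a disjunction of extended literals; a simple implication is $\mathcal A^\land\to\mathcal L^\lor$ with $\mathcal A$ a set of atoms and $\mathcal L^\lor$ a simple disjunction; a simple formula is a conjunction of simple implications. For a set $X$ of atoms, the operation $(\cdot)^X_\bot$ is defined as follows: for a disjunction $F$, $F^X_\bot$ is obtained by removing all disjunctive terms that are atoms belonging to $X$; for an implication $F=F_1\to F_2$ whose antecedent $F_1$ is a conjunction, $F^X_\bot$ is $F$ itself if some conjunctive term of $F_1$ is an atom in $X$, and $F_1\to(F_2)^X_\bot$ otherwise; for a conjunction of such implications (or $\bot$) it is applied to each conjunctive term. (In particular for a simple implication $\mathcal A^\land\to\mathcal L^\lor$, the result is unchanged if $\mathcal A\cap X\ne\emptyset$ and is $\mathcal A^\land\to(\mathcal L^\lor)^X_\bot$ otherwise; the same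 operation is applied to the FT-reducts of simple disjunctions and simple formulas.) -}

module Defs where

open import Data.Empty using (⊥)
open import Data.Product using (Σ; ∃; _×_; _,_; proj₁)
open import Relation.Nullary using (¬_; Dec; yes; no)

Classical : Set₁
Classical = (P : Set) → Dec P

-- Infinitary propositional formulas over a type of atoms.
-- An arbitrary set H of formulas is given as a family indexed by a type.
data Formula (Atom : Set) : Set₁ where
  atom : Atom → Formula Atom
  ⋀    : (J : Set) → (J → Formula Atom) → Formula Atom
  ⋁    : (J : Set) → (J → Formula Atom) → Formula Atom
  _⇒_  : Formula Atom → Formula Atom → Formula Atom

infixr 5 _⇒_

module _ {Atom : Set} where

  ⊥f : Formula Atom
  ⊥f = ⋁ ⊥ (λ ())

  ⊤f : Formula Atom
  ⊤f = ⋀ ⊥ (λ ())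

  ¬f : Formula Atom → Formula Atom
  ¬f F = F ⇒ ⊥f

  -- Interpretations (and sets of atoms) are predicates on atoms.
  Sat : (Atom → Set) → Formula Atom → Set
  Sat I (atom p) = I p
  Sat I (⋀ J f)  = (j : J) → Sat I (f j)
  Sat I (⋁ J f)  = Σ J (λ j → Sat I (f j))
  Sat I (F ⇒ G)  = Sat I F → Sat I G

  FT : Classical → (Atom → Set) → Formula Atom → Formula Atom
  FT lem I (atom p) with lem (I p)
  ... | yes _ = atom p
  ... | no  _ = ⊥f
  FT lem I (⋀ J f) = ⋀ J (λ j → FT lem I (f j))
  FT lem I (⋁ J f) = ⋁ J (λ j → FT lem I (f j))
  FT lem I (F ⇒ G) with lem (Sat I (F ⇒ G))
  ... | yes _ = FT lem I F ⇒ FT lem I G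
  ... | no  _ = ⊥f

  AtomIn : (Atom → Set) → Formula Atom → Set
  AtomIn X (atom p) = X p
  AtomIn X _        = ⊥

  -- It is only specified on disjunctions,
  -- implications whose antecedent is a conjunction, and conjunctions
  -- of such implications; elsewhere it is (arbitrarily) the identity.
  botX : Classical → (Atom → Set) → Formula Atom → Formula Atom
  botX lem X (⋁ J f) = ⋁ (Σ J (λ j → ¬ AtomIn X (f j))) (λ k → f (proj₁ k))
  botX lem X (⋀ J a ⇒ F₂) with lem (Σ J (λ j → AtomIn X (a j)))
  ... | yes _ = ⋀ J a ⇒ F₂
  ... | no  _ = ⋀ J a ⇒ botX lem X F₂
  botX lem X (⋀ K g) = ⋀ K (λ k → botX lem X (g k))
  botX lem X F = F

  data IsBot : Formula Atom → Set₁ where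
    isBot : ∀ {J f} → ¬ J → IsBot (⋁ J f)

  data ExtLit : Formula Atom → Set₁ where
    lit-pos    : ∀ p → ExtLit (atom p)
    lit-neg    : ∀ {p B} → IsBot B → ExtLit (atom p ⇒ B)
    lit-negneg : ∀ {p B B′} → IsBot B → IsBot B′ → ExtLit ((atom p ⇒ B) ⇒ B′)

  data IsAtom : Formula Atom → Set where
    isAtom : ∀ p → IsAtom (atom p)

  data SimpleDisj : Formula Atom → Set₁ where
    simpleDisj : ∀ {J f} → (∀ j → ExtLit (f j)) → SimpleDisj (⋁ J f)

  data SimpleImp : Formula Atom → Set₁ where
    simpleImp : ∀ {J a L} → (∀ j → IsAtom (a j)) → SimpleDisj L → SimpleImp (⋀ J a ⇒ L)

  data SimpleFormula : Formula Atom → Set₁ where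
    simpleFormula : ∀ {K g} → (∀ k → SimpleImp (g k)) → SimpleFormula (⋀ K g)

-- The FT-reduct with respect to I is satisfied by I exactly when the formula is,
-- and it keeps an atom p in place precisely when I ⊨ p.  Hence, on the formulas I
-- satisfies, the reduct marks the same disjuncts and antecedent atoms as members
-- of X, and (·)^X_⊥ discards the same material on both sides.  If I falsifies an
-- implication, its reduct is ⊥ and its (·)^X_⊥-image, which entails it, is false
-- too.  Only the shape of G matters: its disjuncts need not be extended literals.
module Submission where

open import Data.Empty using (⊥-elim)
open import Data.Product using (Σ; _×_; _,_; proj₁; proj₂)
open import Data.Sum using (_⊎_; inj₁; inj₂)
open import Function.Base using (id; _∘_)
open import Function.Bundles using (_⇔_; mk⇔; Equivalence)
open import Relation.Nullary using (¬_; yes; no)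

open import Defs

open Equivalence using (to; from)

module _ (lem : Classical) {Atom : Set} (X I : Atom → Set) where

  Sat-FT : ∀ F → Sat I (FT lem I F) ⇔ Sat I F
  Sat-FT (atom p) with lem (I p)
  ... | yes _  = mk⇔ id id
  ... | no ¬Ip = mk⇔ (λ { (() , _) }) (⊥-elim ∘ ¬Ip)
  Sat-FT (⋀ J f) = mk⇔ (λ h j → to (Sat-FT (f j)) (h j)) (λ h j → from (Sat-FT (f j)) (h j))
  Sat-FT (⋁ J f) = mk⇔ (λ (j , s) → j , to (Sat-FT (f j)) s) (λ (j , s) → j , from (Sat-FT (f j)) s)
  Sat-FT (F ⇒ G) with lem (Sat I (F ⇒ G))
  ... | yes _ = mk⇔ (λ h → to (Sat-FT G) ∘ h ∘ from (Sat-FT F)) (λ h → from (Sat-FT G) ∘ h ∘ to (Sat-FT F))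
  ... | no ⊭F⇒G = mk⇔ (λ { (() , _) }) (⊥-elim ∘ ⊭F⇒G)

  AtomIn-FT : ∀ F → Sat I F → AtomIn X (FT lem I F) ⇔ AtomIn X F
  AtomIn-FT (atom p) Ip with lem (I p)
  ... | yes _  = mk⇔ id id
  ... | no ¬Ip = ⊥-elim (¬Ip Ip)
  AtomIn-FT (⋀ J f) _ = mk⇔ id id
  AtomIn-FT (⋁ J f) _ = mk⇔ id id
  AtomIn-FT (F ⇒ G) _ with lem (Sat I (F ⇒ G))
  ... | yes _ = mk⇔ id id
  ... | no _  = mk⇔ id id

  Sat-botX⇒Sat : ∀ F → Sat I (botX lem X F) → Sat I F
  Sat-botX⇒Sat (⋁ J f) ((j , _) , s) = j , s
  Sat-botX⇒Sat (⋀ J a ⇒ F) with lem (Σ J (λ j → AtomIn X (a j)))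
  ... | yes _ = id
  ... | no _  = Sat-botX⇒Sat F ∘_
  Sat-botX⇒Sat (⋀ K g) h k = Sat-botX⇒Sat (g k) (h k)
  Sat-botX⇒Sat (atom p) = id
  Sat-botX⇒Sat (atom p ⇒ G) = id
  Sat-botX⇒Sat (⋁ J f ⇒ G) = id
  Sat-botX⇒Sat ((F ⇒ F′) ⇒ G) = id

  Sat-botX-⇒ : ∀ {J} (a : J → Formula Atom) F →
               Sat I (botX lem X (⋀ J a ⇒ F)) ⇔
               (Sat I (⋀ J a ⇒ F) × (Sat I (⋀ J a) → ¬ Σ J (λ j → AtomIn X (a j)) → Sat I (botX lem X F)))
  Sat-botX-⇒ {J} a F with lem (Σ J (λ j → AtomIn X (a j)))
  ... | yes inX = mk⇔ (λ h → h , λ _ ¬inX → ⊥-elim (¬inX inX)) proj₁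
  ... | no ¬inX = mk⇔ (λ h → Sat-botX⇒Sat F ∘ h , λ x _ → h x) (λ (_ , h) x → h x ¬inX)

  BotXCommutesWithFT : Formula Atom → Set
  BotXCommutesWithFT F = Sat I (botX lem X F) ⇔ Sat I (botX lem X (FT lem I F))

  ⋁-botXCommutesWithFT : ∀ {J} (f : J → Formula Atom) → BotXCommutesWithFT (⋁ J f)
  ⋁-botXCommutesWithFT f = mk⇔
    (λ ((j , ∉X) , s) → (j , ∉X ∘ to (AtomIn-FT (f j) s)) , from (Sat-FT (f j)) s)
    (λ ((j , ∉X) , s) → let s′ = to (Sat-FT (f j)) s in
                        (j , ∉X ∘ from (AtomIn-FT (f j) s′)) , s′)

  ⋀-botXCommutesWithFT : ∀ {K} (g : K → Formula Atom) →
                         (∀ k → BotXCommutesWithFT (g k)) → BotXCommutesWithFT (⋀ K g)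
  ⋀-botXCommutesWithFT g c = mk⇔ (λ h k → to (c k) (h k)) (λ h k → from (c k) (h k))

  ⇒-botXCommutesWithFT : ∀ {J} (a : J → Formula Atom) F →
                         BotXCommutesWithFT F → BotXCommutesWithFT (⋀ J a ⇒ F)
  ⇒-botXCommutesWithFT {J} a F c with lem (Sat I (⋀ J a ⇒ F))
  ... | no ⊭a⇒F = mk⇔ (⊥-elim ∘ ⊭a⇒F ∘ Sat-botX⇒Sat (⋀ J a ⇒ F)) (λ { ((() , _) , _) })
  ... | yes ⊨a⇒F = mk⇔
    (λ h → from (Sat-botX-⇒ a′ F′)
       ( from (Sat-FT F) ∘ ⊨a⇒F ∘ to (Sat-FT (⋀ J a))
       , λ x ∉X → let x′ = to (Sat-FT (⋀ J a)) x in
                  to c (proj₂ (to (Sat-botX-⇒ a F) h) x′ (∉X ∘ from (guard-FT x′)))))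
    (λ h → from (Sat-botX-⇒ a F)
       ( ⊨a⇒F
       , λ x ∉X → let x′ = from (Sat-FT (⋀ J a)) x in
                  from c (proj₂ (to (Sat-botX-⇒ a′ F′) h) x′ (∉X ∘ to (guard-FT x)))))
    where
    a′ = λ j → FT lem I (a j)
    F′ = FT lem I F
    guard-FT : Sat I (⋀ J a) → Σ J (λ j → AtomIn X (a′ j)) ⇔ Σ J (λ j → AtomIn X (a j))
    guard-FT x = mk⇔ (λ (j , inX) → j , to (AtomIn-FT (a j) (x j)) inX)
                     (λ (j , inX) → j , from (AtomIn-FT (a j) (x j)) inX)

  simpleImp-botXCommutesWithFT : ∀ {G} → SimpleImp G → BotXCommutesWithFT G
  simpleImp-botXCommutesWithFT (simpleImp {a = a} {L = ⋁ J f} _ (simpleDisj _)) =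
    ⇒-botXCommutesWithFT a (⋁ J f) (⋁-botXCommutesWithFT f)

lemma5 : (lem : Classical) {Atom : Set} (G : Formula Atom) →
         SimpleDisj G ⊎ SimpleFormula G →
         (X I : Atom → Set) →
         Sat I (botX lem X G) ⇔ Sat I (botX lem X (FT lem I G))
lemma5 lem (⋁ J f) (inj₁ (simpleDisj _)) X I = ⋁-botXCommutesWithFT lem X I f
lemma5 lem (⋀ K g) (inj₂ (simpleFormula imps)) X I =
  ⋀-botXCommutesWithFT lem X I g (simpleImp-botXCommutesWithFT lem X I ∘ imps)
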